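{- Let $m,n\ge1$ and let $v$ be a vertex of $G=G_{m\times n}$. For any 180-degree trail at $v$, the set of vertices of $G$ lying on the trail that lie on exactly one of its straight line segments forms an even kernel of $G$ containing $v$.
   Context: $G_{m\times n}=P_m\square P_n$ is the grid graph with vertex set $[m]\times[n]$, $(i,j)\sim(i',j')$ iff $|i-i'|+|j-j'|=1$, embedded in $R=[0,m+1]\times[0,n+1]$. A ray from a vertex $v$ leaves $v$ in one of the four diagonal directions $(\pm1,\pm1)$ and travels in a straight line, reflecting off the sides of $R$ in the usual manner; it stops when it hits a corner of $R$ or returns to $v$. A trail at $v$ is the collection of straight line segments (between $v$ and reflection points on the boundary of $R$, and between consecutive boundary points) traced by a single ray from $v$ or by two rays from $v$ in different directions. Only trails with exactly two straight line segments touching $v$ are considered; such a trail is a 180-degree trail if these two segments are collinear at $v$. An even kernel of a simple graph $H$ is a nonempty independent vertex set $S$ such that every vertex $x\notin S$ has an even number of neighbors in $S$. -}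

module Defs where

open import Data.Nat using (ℕ; zero; suc; _+_; _∸_; _≤_; _<_; _≡ᵇ_)
open import Data.Nat.Divisibility using (_∣_)
open import Data.Bool using (Bool; true; false; not; _∨_; _xor_; if_then_else_)
open import Data.Fin using (Fin)
open import Data.Product using (_×_; _,_; proj₁; proj₂; ∃; ∃-syntax)
open import Data.Sum using (_⊎_)
open import Relation.Nullary using (¬_)
open import Data.Empty using (⊥)
open import Relation.Binary.PropositionalEquality using (_≡_)

-- Points of the lattice Z^2 inside R = [0,m+1] x [0,n+1] (coordinates in ℕ).
-- Vertices of G_{m×n} are the points (i,j) with 1 ≤ i ≤ m, 1 ≤ j ≤ n.

Pt : Set
Pt = ℕ × ℕ

InGrid : ℕ → ℕ → Pt → Set
InGrid m n (i , j) = (1 ≤ i × i ≤ m) × (1 ≤ j × j ≤ n)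

-- the four lattice neighbours (i±1,j), (i,j±1); for a grid vertex these are
-- exactly the points at L1-distance 1
nb : Fin 4 → Pt → Pt
nb Fin.zero (i , j) = (suc i , j)
nb (Fin.suc Fin.zero) (i , j) = (i ∸ 1 , j)
nb (Fin.suc (Fin.suc Fin.zero)) (i , j) = (i , suc j)
nb (Fin.suc (Fin.suc (Fin.suc Fin.zero))) (i , j) = (i , j ∸ 1)

Adj : Pt → Pt → Set
Adj x y = ∃[ k ] y ≡ nb k x

b2n : Bool → ℕ
b2n true = 1
b2n false = 0

count4 : (Fin 4 → Bool) → ℕ
count4 c = b2n (c Fin.zero) + (b2n (c (Fin.suc Fin.zero))
         + (b2n (c (Fin.suc (Fin.suc Fin.zero)))
         + b2n (c (Fin.suc (Fin.suc (Fin.suc Fin.zero))))))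

-- x has an even number of neighbours (in G) lying in S:
-- c marks which of the four candidate neighbours are grid vertices in S
EvenNbrs : ℕ → ℕ → (Pt → Set) → Pt → Set
EvenNbrs m n S x =
  ∃[ c ] ((∀ k → (c k ≡ true → InGrid m n (nb k x) × S (nb k x))
                × (InGrid m n (nb k x) × S (nb k x) → c k ≡ true))
          × 2 ∣ count4 c)

record EvenKernel (m n : ℕ) (S : Pt → Set) : Set where
  field
    subset      : ∀ x → S x → InGrid m n x
    nonempty    : ∃[ x ] S x
    independent : ∀ x y → Adj x y → S x → S y → ⊥
    even        : ∀ x → InGrid m n x → ¬ S x → EvenNbrs m n S x

-- Rays.  A direction (dx , dy) : Bool × Bool, true = +1, false = -1.

Dir : Set
Dir = Bool × Bool

neg : Dir → Dir
neg (dx , dy) = (not dx , not dy)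

-- slope of a diagonal direction: false = slope +1, true = slope -1
slope : Dir → Bool
slope (dx , dy) = dx xor dy

State : Set
State = Pt × Dir

mv : Bool → ℕ → ℕ
mv true x = suc x
mv false x = x ∸ 1

onSide : ℕ → ℕ → Bool
onSide M x = (x ≡ᵇ 0) ∨ (x ≡ᵇ M)

-- one unit diagonal step, reflecting off the sides of R = [0,m+1]×[0,n+1]
-- (the direction stored at a boundary point is the outgoing one)
step : ℕ → ℕ → State → State
step m n ((x , y) , (dx , dy)) =
  let x′ = mv dx x ; y′ = mv dy y in
  ((x′ , y′) , ((if onSide (suc m) x′ then not dx else dx)
              , (if onSide (suc n) y′ then not dy else dy)))

iter : ℕ → ℕ → ℕ → State → State
iter m n zero s = s
iter m n (suc k) s = step m n (iter m n k s)

IsCorner : ℕ → ℕ → Pt → Set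
IsCorner m n (x , y) = (x ≡ 0 ⊎ x ≡ suc m) × (y ≡ 0 ⊎ y ≡ suc n)

-- position / direction of the ray from v in direction d after k unit steps
-- (ignoring stopping)
posAt : ℕ → ℕ → Pt → Dir → ℕ → Pt
posAt m n v d k = proj₁ (iter m n k (v , d))

dirAt : ℕ → ℕ → Pt → Dir → ℕ → Dir
dirAt m n v d k = proj₂ (iter m n k (v , d))

-- the ray stops at the first time k ≥ 1 at which it is at a corner or at v
Stops : ℕ → ℕ → Pt → Dir → ℕ → Set
Stops m n v d k = IsCorner m n (posAt m n v d k) ⊎ posAt m n v d k ≡ v

Alive : ℕ → ℕ → Pt → Dir → ℕ → Set
Alive m n v d k = ∀ j → 1 ≤ j → j < k → ¬ Stops m n v d j

OnRay : ℕ → ℕ → Pt → Dir → Pt → Bool → Set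
OnRay m n v d w s = ∃[ k ] (Alive m n v d k × posAt m n v d k ≡ w × slope (dirAt m n v d k) ≡ s)

ReturnsWith : ℕ → ℕ → Pt → Dir → Dir → Set
ReturnsWith m n v d a =
  ∃[ T ] (1 ≤ T × Alive m n v d T × posAt m n v d T ≡ v × dirAt m n v d T ≡ a)

-- 180-degree trails at v (with exactly two segments touching v).
--  * oneRay d : a single ray from v in direction d that returns to v arriving
--    in direction d (so its first and last segments are collinear at v);
--  * twoRays d : the rays from v in the opposite directions d and -d, where
--    neither ray returns to v along a third segment (a ray returning to v can
--    only arrive in its own initial direction, in which case the two rays
--    trace the same two segments at v).

data Trail180 (m n : ℕ) (v : Pt) : Set where
  oneRay  : (d : Dir) → ReturnsWith m n v d d → Trail180 m n v
  twoRays : (d : Dir)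
          → (∀ a → ReturnsWith m n v d a → a ≡ d)
          → (∀ a → ReturnsWith m n v (neg d) a → a ≡ neg d)
          → Trail180 m n v

OnTrail : ∀ {m n v} → Trail180 m n v → Pt → Bool → Set
OnTrail {m} {n} {v} (oneRay d _) w s = OnRay m n v d w s
OnTrail {m} {n} {v} (twoRays d _ _) w s = OnRay m n v d w s ⊎ OnRay m n v (neg d) w s

-- Through a lattice point pass exactly two diagonal lines,
-- one of each slope.
ExactlyOneSeg : ∀ {m n v} → Trail180 m n v → Pt → Set
ExactlyOneSeg {m} {n} t w =
  InGrid m n w × ((OnTrail t w false × ¬ OnTrail t w true)
                ⊎ (OnTrail t w true × ¬ OnTrail t w false))

-- Along a ray every step changes both coordinates by one, so all points of a
-- trail have the colour (x + y mod 2) of v, while adjacent vertices have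
-- different colours: the set is independent.  The trail is a union of unit
-- diagonal segments, each used entirely or not at all: crossing one endpoint
-- along the segment's slope propagates to the other endpoint, forwards along the
-- billiard flow or backwards to the previous state.  The four neighbours of a
-- vertex are the corners of a diamond of four such segments; a neighbour lies on
-- exactly one segment of the trail iff exactly one of its two sides of the
-- diamond is used, and around the 4-cycle of sides this happens an even number
-- of times.  At v a 180-degree trail runs only along the line of its initial
-- direction, since its rays can return to v only in that direction.  Everything
-- is decidable because the billiard flow on R has period 4(m+1)(n+1).

module Submission where

open import Defs
open import Data.Bool using (Bool; true; false; not; _xor_; if_then_else_; T)
open import Data.Bool.Properties
  using (T-≡; ¬-not; not-¬; not-involutive; not-distribˡ-xor; not-distribʳ-xor)
import Data.Bool.Properties as Bool
open import Data.Empty using (⊥; ⊥-elim)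
open import Data.Fin as Fin using (Fin)
open import Data.Nat using (ℕ; zero; suc; _+_; _*_; _∸_; _≤_; _<_; _≡ᵇ_; z≤n; s≤s; _≟_; _≤?_)
open import Data.Nat.Divisibility using (_∣_; divides; m∣m*n; n∣m*n)
open import Data.Nat.Properties
open import Data.Product using (_×_; _,_; proj₁; proj₂; ∃-syntax)
import Data.Product as Prod
open import Data.Product.Properties using (≡-dec)
open import Data.Sum using (_⊎_; inj₁; inj₂; [_,_])
import Data.Sum as Sum
open import Function using (_∘_; case_of_; Equivalence; _⇔_; mk⇔)
open import Function.Properties.Equivalence using () renaming (sym to ⇔-sym)
open import Relation.Binary.Definitions using (tri<; tri≈; tri>)
open import Relation.Binary.PropositionalEquality hiding ([_])
open import Relation.Nullary using (Dec; yes; no; does; ¬_; ¬?)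
open import Relation.Nullary.Decidable using (map′; _×-dec_; _⊎-dec_; _→-dec_; does-⇔)

≡ᵇ-false : ∀ {x y} → x ≢ y → (x ≡ᵇ y) ≡ false
≡ᵇ-false {x} {y} x≢y = ¬-not (x≢y ∘ ≡ᵇ⇒≡ x y ∘ Equivalence.from T-≡)

≡ᵇ-refl : ∀ x → (x ≡ᵇ x) ≡ true
≡ᵇ-refl x = Equivalence.to T-≡ (≡⇒≡ᵇ x x refl)

xor-not-not : ∀ a b → not a xor not b ≡ a xor b
xor-not-not true  b = refl
xor-not-not false b = not-involutive b

ExactlyOne : Set → Set → Set
ExactlyOne P Q = (P × ¬ Q) ⊎ (Q × ¬ P)

exactlyOne-map : ∀ {P P′ Q Q′} → P ⇔ P′ → Q ⇔ Q′ → ExactlyOne P Q → ExactlyOne P′ Q′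
exactlyOne-map P⇔P′ Q⇔Q′ =
  Sum.map (Prod.map (Equivalence.to P⇔P′) (_∘ Equivalence.from Q⇔Q′))
          (Prod.map (Equivalence.to Q⇔Q′) (_∘ Equivalence.from P⇔P′))

xor-does : ∀ {P Q} (P? : Dec P) (Q? : Dec Q) → does P? xor does Q? ≡ true ⇔ ExactlyOne P Q
xor-does (yes p) (yes q) = mk⇔ (λ ()) λ { (inj₁ (_ , ¬q)) → ⊥-elim (¬q q) ; (inj₂ (_ , ¬p)) → ⊥-elim (¬p p) }
xor-does (yes p) (no ¬q) = mk⇔ (λ _ → inj₁ (p , ¬q)) (λ _ → refl)
xor-does (no ¬p) (yes q) = mk⇔ (λ _ → inj₂ (q , ¬p)) (λ _ → refl)
xor-does (no ¬p) (no ¬q) = mk⇔ (λ ()) λ { (inj₁ (p , _)) → ⊥-elim (¬p p) ; (inj₂ (q , _)) → ⊥-elim (¬q q) }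

exactlyOne-at : ∀ {P : Bool → Set} s → P s → ¬ P (not s) → ExactlyOne (P false) (P true)
exactlyOne-at false p ¬p = inj₁ (p , ¬p)
exactlyOne-at true  p ¬p = inj₂ (p , ¬p)

∃-Bool? : {P : Bool → Set} → (∀ b → Dec (P b)) → Dec (∃[ b ] P b)
∃-Bool? P? = map′ [ (true ,_) , (false ,_) ] (λ { (true , p) → inj₁ p ; (false , p) → inj₂ p })
                  (P? true ⊎-dec P? false)

∃-Dir? : {P : Dir → Set} → (∀ d → Dec (P d)) → Dec (∃[ d ] P d)
∃-Dir? P? = map′ (λ (a , b , p) → (a , b) , p) (λ ((a , b) , p) → a , b , p)
                 (∃-Bool? λ a → ∃-Bool? λ b → P? (a , b))

_≟ᵖ_ : (p q : Pt) → Dec (p ≡ q)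
_≟ᵖ_ = ≡-dec _≟_ _≟_

_≟ᵈ_ : (d e : Dir) → Dec (d ≡ e)
_≟ᵈ_ = ≡-dec Bool._≟_ Bool._≟_

_≟ˢ_ : (s t : State) → Dec (s ≡ t)
_≟ˢ_ = ≡-dec _≟ᵖ_ _≟ᵈ_

-- The terms are the edges of the 4-cycle a–b–c–d, along which the label
-- changes an even number of times.
xor-cycle-even : ∀ a b c d → 2 ∣ b2n (d xor a) + (b2n (b xor c) + (b2n (b xor a) + b2n (d xor c)))
xor-cycle-even true  true  true  true  = divides 0 refl
xor-cycle-even true  true  true  false = divides 1 refl
xor-cycle-even true  true  false true  = divides 1 refl
xor-cycle-even true  true  false false = divides 1 refl
xor-cycle-even true  false true  true  = divides 1 refl
xor-cycle-even true  false true  false = divides 2 refl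
xor-cycle-even true  false false true  = divides 1 refl
xor-cycle-even true  false false false = divides 1 refl
xor-cycle-even false true  true  true  = divides 1 refl
xor-cycle-even false true  true  false = divides 1 refl
xor-cycle-even false true  false true  = divides 2 refl
xor-cycle-even false true  false false = divides 1 refl
xor-cycle-even false false true  true  = divides 1 refl
xor-cycle-even false false true  false = divides 1 refl
xor-cycle-even false false false true  = divides 1 refl
xor-cycle-even false false false false = divides 0 refl

onSide-interior : ∀ {M x} → 1 ≤ x → x < M → onSide M x ≡ false
onSide-interior {x = suc x} _ x<M = ≡ᵇ-false (<⇒≢ x<M)

onSide-true : ∀ {M} x → onSide M x ≡ true → x ≡ 0 ⊎ x ≡ M
onSide-true zero    _  = inj₁ refl
onSide-true (suc x) eq = inj₂ (≡ᵇ⇒≡ (suc x) _ (Equivalence.from T-≡ eq))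

bounce : ℕ → ℕ × Bool → ℕ × Bool
bounce M (x , d) = mv d x , (if onSide M (mv d x) then not d else d)

bounce^ : ℕ → ℕ → ℕ × Bool → ℕ × Bool
bounce^ M zero    s = s
bounce^ M (suc k) s = bounce M (bounce^ M k s)

-- Both x and the next point x ± 1 in direction d lie in [0, M].
Admissible : ℕ → ℕ × Bool → Set
Admissible M (x , true)  = x < M
Admissible M (x , false) = 1 ≤ x × x ≤ M

interior-admissible : ∀ {M x} d → 1 ≤ x → x ≤ M → Admissible (suc M) (x , d)
interior-admissible true  _   x≤M = s≤s x≤M
interior-admissible false 1≤x x≤M = 1≤x , m≤n⇒m≤1+n x≤M

admissible-≤ : ∀ {M} s → Admissible M s → proj₁ s ≤ M
admissible-≤ (x , true)  x<M        = <⇒≤ x<M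
admissible-≤ (x , false) (_ , x≤M) = x≤M

mv-inverse : ∀ {M x} d → Admissible M (x , d) → mv (not d) (mv d x) ≡ x
mv-inverse {x = x}     true  _ = refl
mv-inverse {x = suc x} false _ = refl

bounce-admissible : ∀ {M} s → Admissible M s → Admissible M (bounce M s)
bounce-admissible {M} (x , true) x<M with suc x ≡ᵇ M in eq
... | true  = s≤s z≤n , x<M
... | false = ≤∧≢⇒< x<M λ x+1≡M → subst T eq (≡⇒≡ᵇ (suc x) M x+1≡M)
bounce-admissible (suc zero , false)    (_ , 1≤M)   = 1≤M
bounce-admissible (suc (suc x) , false) (_ , x+2≤M)
  rewrite onSide-interior {x = suc x} (s≤s z≤n) x+2≤M = s≤s z≤n , <⇒≤ x+2≤M

bounce^-admissible : ∀ {M} k s → Admissible M s → Admissible M (bounce^ M k s)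
bounce^-admissible zero    s adm = adm
bounce^-admissible (suc k) s adm = bounce-admissible _ (bounce^-admissible k s adm)

bounce^-+ : ∀ M a b s → bounce^ M (a + b) s ≡ bounce^ M a (bounce^ M b s)
bounce^-+ M zero    b s = refl
bounce^-+ M (suc a) b s = cong (bounce M) (bounce^-+ M a b s)

bounce^-comm : ∀ M a b s → bounce^ M a (bounce^ M b s) ≡ bounce^ M b (bounce^ M a s)
bounce^-comm M a b s = begin
  bounce^ M a (bounce^ M b s) ≡⟨ bounce^-+ M a b s ⟨
  bounce^ M (a + b) s         ≡⟨ cong (λ k → bounce^ M k s) (+-comm a b) ⟩
  bounce^ M (b + a) s         ≡⟨ bounce^-+ M b a s ⟩
  bounce^ M b (bounce^ M a s) ∎
  where open ≡-Reasoning

ascend : ∀ M j x → j + x < M → bounce^ M j (x , true) ≡ (j + x , true)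
ascend M zero    x _ = refl
ascend M (suc j) x j+x<M
  rewrite ascend M j x (<-trans (n<1+n _) j+x<M)
        | ≡ᵇ-false (<⇒≢ j+x<M) = refl

ascend-to-top : ∀ M → bounce^ (suc M) (suc M) (0 , true) ≡ (suc M , false)
ascend-to-top M
  rewrite ascend (suc M) M 0 (s≤s (≤-reflexive (+-identityʳ M))) | +-identityʳ M | ≡ᵇ-refl M = refl

bounce^-suc′ : ∀ M k s → bounce^ M (suc k) s ≡ bounce^ M k (bounce M s)
bounce^-suc′ M zero    s = refl
bounce^-suc′ M (suc k) s = cong (bounce M) (bounce^-suc′ M k s)

descend : ∀ M j x → 1 ≤ x → j + x ≤ M → bounce^ M j (j + x , false) ≡ (x , false)
descend M zero    x _   _ = refl
descend M (suc j) x 1≤x j+x<M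
  rewrite bounce^-suc′ M j (suc j + x , false)
        | onSide-interior {M} {j + x} (≤-trans 1≤x (m≤n+m x j)) j+x<M
  = descend M j x 1≤x (<⇒≤ j+x<M)

descend-to-bottom : ∀ M → bounce^ (suc M) (suc M) (suc M , false) ≡ (0 , true)
descend-to-bottom M = cong (bounce (suc M)) (begin
  bounce^ (suc M) M (suc M , false) ≡⟨ cong (λ y → bounce^ (suc M) M (y , false)) (+-comm 1 M) ⟩
  bounce^ (suc M) M (M + 1 , false) ≡⟨ descend (suc M) M 1 (s≤s z≤n) (≤-reflexive (+-comm M 1)) ⟩
  (1 , false)                       ∎)
  where open ≡-Reasoning

admissible-on-orbit : ∀ {M} s → Admissible (suc M) s → ∃[ k ] bounce^ (suc M) k (0 , true) ≡ s
admissible-on-orbit (x , true) x<M =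
  x , trans (ascend _ x 0 (subst (_< _) (sym (+-identityʳ x)) x<M)) (cong (_, true) (+-identityʳ x))
admissible-on-orbit {M} (x , false) (1≤x , x≤M) = suc M ∸ x + suc M , (begin
  bounce^ (suc M) (suc M ∸ x + suc M) (0 , true)
    ≡⟨ bounce^-+ (suc M) (suc M ∸ x) (suc M) _ ⟩
  bounce^ (suc M) (suc M ∸ x) (bounce^ (suc M) (suc M) (0 , true))
    ≡⟨ cong (bounce^ (suc M) (suc M ∸ x)) (ascend-to-top M) ⟩
  bounce^ (suc M) (suc M ∸ x) (suc M , false)
    ≡⟨ cong (λ y → bounce^ (suc M) (suc M ∸ x) (y , false)) (sym (m∸n+n≡m x≤M)) ⟩
  bounce^ (suc M) (suc M ∸ x) (suc M ∸ x + x , false)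
    ≡⟨ descend (suc M) (suc M ∸ x) x 1≤x (≤-reflexive (m∸n+n≡m x≤M)) ⟩
  (x , false) ∎)
  where open ≡-Reasoning

bounce^-period : ∀ {M} s → Admissible (suc M) s → bounce^ (suc M) (suc M + suc M) s ≡ s
bounce^-period {M} s adm with admissible-on-orbit s adm
... | k , refl = begin
  bounce^ (suc M) (suc M + suc M) (bounce^ (suc M) k (0 , true))
    ≡⟨ bounce^-comm (suc M) (suc M + suc M) k _ ⟩
  bounce^ (suc M) k (bounce^ (suc M) (suc M + suc M) (0 , true))
    ≡⟨ cong (bounce^ (suc M) k) (bounce^-+ (suc M) (suc M) (suc M) _) ⟩
  bounce^ (suc M) k (bounce^ (suc M) (suc M) (bounce^ (suc M) (suc M) (0 , true)))
    ≡⟨ cong (λ s → bounce^ (suc M) k (bounce^ (suc M) (suc M) s)) (ascend-to-top M) ⟩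
  bounce^ (suc M) k (bounce^ (suc M) (suc M) (suc M , false))
    ≡⟨ cong (bounce^ (suc M) k) (descend-to-bottom M) ⟩
  bounce^ (suc M) k (0 , true) ∎
  where open ≡-Reasoning

bounce^-periodic : ∀ {M k} s → Admissible (suc M) s → (suc M + suc M) ∣ k → bounce^ (suc M) k s ≡ s
bounce^-periodic {M} s adm (divides q refl) = go q
  where
  go : ∀ q → bounce^ (suc M) (q * (suc M + suc M)) s ≡ s
  go zero    = refl
  go (suc q) = trans (bounce^-+ (suc M) (suc M + suc M) (q * (suc M + suc M)) s)
                     (trans (cong (bounce^ (suc M) (suc M + suc M)) (go q)) (bounce^-period s adm))

at-zero-upward : ∀ {M d} → Admissible M (0 , d) → d ≡ true
at-zero-upward {d = true}  _       = refl
at-zero-upward {d = false} (() , _)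

at-side-downward : ∀ {M d} → Admissible M (M , d) → d ≡ false
at-side-downward {d = true}  M<M = ⊥-elim (<-irrefl refl M<M)
at-side-downward {d = false} _   = refl

side-direction-unique : ∀ {M x d e} → onSide M x ≡ true
                      → Admissible M (x , d) → Admissible M (x , e) → d ≡ e
side-direction-unique {x = x} on-side adm-d adm-e with onSide-true x on-side
... | inj₁ refl = trans (at-zero-upward adm-d) (sym (at-zero-upward adm-e))
... | inj₂ refl = trans (at-side-downward adm-d) (sym (at-side-downward adm-e))

off-side-interior : ∀ {M x d} → onSide (suc M) x ≡ false → Admissible (suc M) (x , d) → 1 ≤ x × x ≤ M
off-side-interior {M} {suc x} off-side adm =
  s≤s z≤n , ≤-pred (≤∧≢⇒< (admissible-≤ _ adm) λ { refl → case trans (sym (≡ᵇ-refl x)) off-side of λ () })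

-- At a side of [0, M] only one direction is admissible, so a move ending there
-- leaves in that direction e and must have arrived in direction - e.
bounce-direction : ∀ {M a d e} → Admissible M (a , d) → Admissible M (mv d a , e)
  → (onSide M (mv d a) ≡ true × proj₂ (bounce M (a , d)) ≡ e × d ≡ not e)
  ⊎ (onSide M (mv d a) ≡ false × proj₂ (bounce M (a , d)) ≡ d)
bounce-direction {M} {a} {d} {e} adm adm-e with onSide M (mv d a) in on-side
... | true  = inj₁ (refl , not-d≡e , trans (sym (not-involutive d)) (cong not not-d≡e))
  where
  not-d≡e : not d ≡ e
  not-d≡e = side-direction-unique on-side
    (subst (λ b → Admissible M (mv d a , (if b then not d else d))) on-side (bounce-admissible (a , d) adm))
    adm-e
... | false = inj₂ (refl , refl)

neg-involutive : ∀ d → neg (neg d) ≡ d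
neg-involutive (dx , dy) = cong₂ _,_ (not-involutive dx) (not-involutive dy)

slope-neg : ∀ d → slope (neg d) ≡ slope d
slope-neg (dx , dy) = xor-not-not dx dy

same-slope : ∀ {f e} → slope f ≡ slope e → f ≢ e → f ≡ neg e
same-slope {true  , true } {true  , true } _  f≢e = ⊥-elim (f≢e refl)
same-slope {true  , false} {true  , false} _  f≢e = ⊥-elim (f≢e refl)
same-slope {false , true } {false , true } _  f≢e = ⊥-elim (f≢e refl)
same-slope {false , false} {false , false} _  f≢e = ⊥-elim (f≢e refl)
same-slope {true  , true } {false , false} _  _   = refl
same-slope {true  , false} {false , true } _  _   = refl
same-slope {false , true } {true  , false} _  _   = refl
same-slope {false , false} {true  , true } _  _   = refl
same-slope {true  , true } {true  , false} () _
same-slope {true  , true } {false , true } () _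
same-slope {true  , false} {true  , true } () _
same-slope {true  , false} {false , false} () _
same-slope {false , true } {true  , true } () _
same-slope {false , true } {false , false} () _
same-slope {false , false} {true  , false} () _
same-slope {false , false} {false , true } () _

move : Dir → Pt → Pt
move (dx , dy) (x , y) = mv dx x , mv dy y

odd : ℕ → Bool
odd zero    = false
odd (suc k) = not (odd k)

colour : Pt → Bool
colour (x , y) = odd x xor odd y

odd-mv : ∀ {M x} d → Admissible M (x , d) → odd (mv d x) ≡ not (odd x)
odd-mv {x = x}     true  _ = refl
odd-mv {x = suc x} false _ = sym (not-involutive (odd x))

colour-adjacent : ∀ {i j y} → Adj (suc i , suc j) y → colour y ≡ not (colour (suc i , suc j))
colour-adjacent {i} {j} (Fin.zero , refl) = sym (not-distribˡ-xor (odd (suc i)) (odd (suc j)))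
colour-adjacent {i} {j} (Fin.suc Fin.zero , refl) =
  trans (sym (not-involutive _)) (cong not (not-distribˡ-xor (odd i) (odd (suc j))))
colour-adjacent {i} {j} (Fin.suc (Fin.suc Fin.zero) , refl) = sym (not-distribʳ-xor (odd (suc i)) (odd (suc j)))
colour-adjacent {i} {j} (Fin.suc (Fin.suc (Fin.suc Fin.zero)) , refl) =
  trans (sym (not-involutive _)) (cong not (not-distribʳ-xor (odd (suc i)) (odd j)))

_⊗_ : ℕ × Bool → ℕ × Bool → State
(x , dx) ⊗ (y , dy) = (x , y) , (dx , dy)

module Billiard (m n : ℕ) where

  Admissible₂ : State → Set
  Admissible₂ ((x , y) , (dx , dy)) = Admissible (suc m) (x , dx) × Admissible (suc n) (y , dy)

  iter-⊗ : ∀ k a b → iter m n k (a ⊗ b) ≡ bounce^ (suc m) k a ⊗ bounce^ (suc n) k b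
  iter-⊗ zero    a b = refl
  iter-⊗ (suc k) a b = cong (step m n) (iter-⊗ k a b)

  iter-admissible : ∀ k s → Admissible₂ s → Admissible₂ (iter m n k s)
  iter-admissible k ((x , y) , (dx , dy)) (adm-x , adm-y) rewrite iter-⊗ k (x , dx) (y , dy) =
    bounce^-admissible k _ adm-x , bounce^-admissible k _ adm-y

  colour-move : ∀ p d → Admissible₂ (p , d) → colour (move d p) ≡ colour p
  colour-move (x , y) (dx , dy) (adm-x , adm-y) =
    trans (cong₂ _xor_ (odd-mv dx adm-x) (odd-mv dy adm-y)) (xor-not-not (odd x) (odd y))

  period : ℕ
  period = (suc m + suc m) * (suc n + suc n)

  iter-period : ∀ s → Admissible₂ s → iter m n period s ≡ s
  iter-period ((x , y) , (dx , dy)) (adm-x , adm-y) = trans (iter-⊗ period (x , dx) (y , dy))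
    (cong₂ _⊗_ (bounce^-periodic _ adm-x (m∣m*n (suc n + suc n)))
                (bounce^-periodic _ adm-y (n∣m*n (suc m + suc m))))

  interior-x⇒¬IsCorner : ∀ {x y} → 1 ≤ x → x ≤ m → ¬ IsCorner m n (x , y)
  interior-x⇒¬IsCorner () _ (inj₁ refl , _)
  interior-x⇒¬IsCorner _ x≤m (inj₂ refl , _) = <-irrefl refl x≤m

  interior-y⇒¬IsCorner : ∀ {x y} → 1 ≤ y → y ≤ n → ¬ IsCorner m n (x , y)
  interior-y⇒¬IsCorner () _ (_ , inj₁ refl)
  interior-y⇒¬IsCorner _ y≤n (_ , inj₂ refl) = <-irrefl refl y≤n

  IsCorner? : ∀ p → Dec (IsCorner m n p)
  IsCorner? (x , y) = ((x ≟ 0) ⊎-dec (x ≟ suc m)) ×-dec ((y ≟ 0) ⊎-dec (y ≟ suc n))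

  InGrid? : ∀ p → Dec (InGrid m n p)
  InGrid? (x , y) = ((1 ≤? x) ×-dec (x ≤? m)) ×-dec ((1 ≤? y) ×-dec (y ≤? n))

  step-direction-in-grid : ∀ q e → InGrid m n (move e q) → proj₂ (step m n (q , e)) ≡ e
  step-direction-in-grid _ _ ((1≤x , x≤m) , (1≤y , y≤n)) =
    cong₂ _,_ (cong (if_then _ else _) (onSide-interior 1≤x (s≤s x≤m)))
              (cong (if_then _ else _) (onSide-interior 1≤y (s≤s y≤n)))

  move-inverse : ∀ p d → Admissible₂ (p , d) → move (neg d) (move d p) ≡ p
  move-inverse _ (dx , dy) (adm-x , adm-y) = cong₂ _,_ (mv-inverse dx adm-x) (mv-inverse dy adm-y)

  move-back : ∀ {p d e} → Admissible₂ (p , d) → d ≡ neg e → (p , d) ≡ (move e (move d p) , neg e)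
  move-back {p} {e = e} adm refl = cong (_, neg e)
    (sym (subst (λ e′ → move e′ (move (neg e) p) ≡ p) (neg-involutive e) (move-inverse p (neg e) adm)))

  step-predecessor : ∀ {s q f e} → Admissible₂ s → step m n s ≡ (q , f) → ¬ IsCorner m n q
    → Admissible₂ (q , e) → f ≢ e → (InGrid m n q → slope f ≡ slope e) → s ≡ (move e q , neg e)
  step-predecessor {(a , b) , (da , db)} {e = ex , ey} (adm-a , adm-b) refl q∉corner (adm-x , adm-y) f≢e slope-f
    with bounce-direction {e = ex} adm-a adm-x | bounce-direction {e = ey} adm-b adm-y
  ... | inj₁ (side-x , _ , _) | inj₁ (side-y , _ , _) =
    ⊥-elim (q∉corner (onSide-true _ side-x , onSide-true _ side-y))
  ... | inj₁ (_ , out-x , da≡) | inj₂ (_ , out-y) =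
    move-back (adm-a , adm-b) (cong₂ _,_ da≡ (¬-not λ db≡ey → f≢e (cong₂ _,_ out-x (trans out-y db≡ey))))
  ... | inj₂ (_ , out-x) | inj₁ (_ , out-y , db≡) =
    move-back (adm-a , adm-b) (cong₂ _,_ (¬-not λ da≡ex → f≢e (cong₂ _,_ (trans out-x da≡ex) out-y)) db≡)
  ... | inj₂ (off-x , out-x) | inj₂ (off-y , out-y) =
    move-back (adm-a , adm-b) (trans (sym f≡d) (same-slope (slope-f q∈G) f≢e))
    where
    f≡d = cong₂ _,_ out-x out-y
    adm-f = iter-admissible 1 ((a , b) , (da , db)) (adm-a , adm-b)
    q∈G = off-side-interior off-x (proj₁ adm-f) , off-side-interior off-y (proj₂ adm-f)

module Rays {m n : ℕ} {v : Pt} (v∈G : InGrid m n v) where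
  open Billiard m n

  start-admissible : ∀ d → Admissible₂ (v , d)
  start-admissible (dx , dy) = interior-admissible dx (proj₁ (proj₁ v∈G)) (proj₂ (proj₁ v∈G))
                             , interior-admissible dy (proj₁ (proj₂ v∈G)) (proj₂ (proj₂ v∈G))

  ray-admissible : ∀ d k → Admissible₂ (iter m n k (v , d))
  ray-admissible d k = iter-admissible k (v , d) (start-admissible d)

  alive-0 : ∀ {d} → Alive m n v d 0
  alive-0 _ _ ()

  alive-1 : ∀ {d} → Alive m n v d 1
  alive-1 (suc _) _ (s≤s ())

  alive-pred : ∀ {d k} → Alive m n v d (suc k) → Alive m n v d k
  alive-pred alive j 1≤j j<k = alive j 1≤j (m<n⇒m<1+n j<k)

  alive-suc : ∀ {d k} → Alive m n v d k → (1 ≤ k → ¬ Stops m n v d k) → Alive m n v d (suc k)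
  alive-suc {k = k} alive live-k j 1≤j j<1+k with m<1+n⇒m<n∨m≡n j<1+k
  ... | inj₁ j<k  = alive j 1≤j j<k
  ... | inj₂ refl = live-k 1≤j

  -- After one full period the ray is back at v, so it has stopped by then.
  alive-bounded : ∀ {d k} → Alive m n v d k → k ≤ period
  alive-bounded {d} alive = ≮⇒≥ λ period<k →
    alive period (s≤s z≤n) period<k (inj₂ (cong proj₁ (iter-period (v , d) (start-admissible d))))

  colour-ray : ∀ d k → colour (posAt m n v d k) ≡ colour v
  colour-ray d zero    = refl
  colour-ray d (suc k) = trans (colour-move _ _ (ray-admissible d k)) (colour-ray d k)

  Stops? : ∀ d j → Dec (Stops m n v d j)
  Stops? d j = IsCorner? (posAt m n v d j) ⊎-dec (posAt m n v d j ≟ᵖ v)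

  Alive? : ∀ d k → Dec (Alive m n v d k)
  Alive? d k = map′ (λ h j 1≤j j<k → h {j} j<k 1≤j) (λ h {j} j<k 1≤j → h j 1≤j j<k)
                    (allUpTo? (λ j → (1 ≤? j) →-dec ¬? (Stops? d j)) k)

  Reaches : Dir → State → Set
  Reaches d s = ∃[ k ] (Alive m n v d k × iter m n k (v , d) ≡ s)

  Reaches? : ∀ d s → Dec (Reaches d s)
  Reaches? d s = map′ (λ (k , _ , h) → k , h) (λ (k , h) → k , s≤s (alive-bounded (proj₁ h)) , h)
                      (anyUpTo? (λ k → Alive? d k ×-dec (iter m n k (v , d) ≟ˢ s)) (suc period))

module Trails {m n : ℕ} {v : Pt} (v∈G : InGrid m n v) where
  open Billiard m n
  open Rays v∈G

  IsRay : Trail180 m n v → Dir → Set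
  IsRay (oneRay d _)    r = r ≡ d
  IsRay (twoRays d _ _) r = r ≡ d ⊎ r ≡ neg d

  Visits : Trail180 m n v → State → Set
  Visits t s = ∃[ r ] (IsRay t r × Reaches r s)

  Visits? : ∀ t s → Dec (Visits t s)
  Visits? (oneRay d _) s =
    map′ (λ h → d , refl , h) (λ { (_ , refl , h) → h }) (Reaches? d s)
  Visits? (twoRays d _ _) s =
    map′ [ (λ h → d , inj₁ refl , h) , (λ h → neg d , inj₂ refl , h) ]
         (λ { (_ , inj₁ refl , h) → inj₁ h ; (_ , inj₂ refl , h) → inj₂ h })
         (Reaches? d s ⊎-dec Reaches? (neg d) s)

  visits-admissible : ∀ {t s} → Visits t s → Admissible₂ s
  visits-admissible (r , _ , k , _ , refl) = ray-admissible r k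

  -- This is where the trail being a 180-degree trail is used.
  return-direction : ∀ t {r e k} → IsRay t r → 1 ≤ k → Alive m n v r k
                   → iter m n k (v , r) ≡ (v , e) → e ≡ r
  return-direction (oneRay d (T , 1≤T , alive-T , at-v , dir-d)) {k = k} refl 1≤k alive-k at-k
    with <-cmp k T
  ... | tri< k<T _ _ = ⊥-elim (alive-T k 1≤k k<T (inj₂ (cong proj₁ at-k)))
  ... | tri≈ _ refl _ = trans (sym (cong proj₂ at-k)) dir-d
  ... | tri> _ _ T<k = ⊥-elim (alive-k T 1≤T T<k (inj₂ at-v))
  return-direction (twoRays d returns-d _) (inj₁ refl) 1≤k alive-k at-k =
    returns-d _ (_ , 1≤k , alive-k , cong proj₁ at-k , cong proj₂ at-k)
  return-direction (twoRays d _ returns-neg-d) (inj₂ refl) 1≤k alive-k at-k =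
    returns-neg-d _ (_ , 1≤k , alive-k , cong proj₁ at-k , cong proj₂ at-k)

  visits-step : ∀ {t q e} → Visits t (q , e) → ¬ IsCorner m n q → Visits t (step m n (q , e))
  visits-step (r , ray , zero , _ , at-0) _ = r , ray , 1 , alive-1 , cong (step m n) at-0
  visits-step {t} {q} (r , ray , suc k , alive , at-k) q∉corner with q ≟ᵖ v
  ... | no q≢v = r , ray , suc (suc k) , alive-suc alive stays , cong (step m n) at-k
    where
    stays : 1 ≤ suc k → ¬ Stops m n v r (suc k)
    stays _ = [ q∉corner ∘ subst (IsCorner m n) (cong proj₁ at-k) , q≢v ∘ trans (sym (cong proj₁ at-k)) ]
  ... | yes refl = r , ray , 1 , alive-1 ,
    cong (λ e → step m n (v , e)) (sym (return-direction t ray (s≤s z≤n) alive at-k))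

  -- Only the initial states of a two-ray trail have no predecessor on it.
  visits-predecessor : ∀ {t q f} → Visits t (q , f)
    → (∃[ s ] (Visits t s × step m n s ≡ (q , f))) ⊎ (q ≡ v × Visits t (v , neg f))
  visits-predecessor (r , ray , suc k , alive , at-k) =
    inj₁ (iter m n k (v , r) , (r , ray , k , alive-pred alive , refl) , at-k)
  visits-predecessor {oneRay d (suc T , _ , alive-T , at-v , dir-d)} (_ , refl , zero , _ , refl) =
    inj₁ (iter m n T (v , d) , (d , refl , T , alive-pred alive-T , refl) , cong₂ _,_ at-v dir-d)
  visits-predecessor {twoRays d _ _} (_ , inj₁ refl , zero , _ , refl) =
    inj₂ (refl , neg d , inj₂ refl , 0 , alive-0 , refl)
  visits-predecessor {twoRays d _ _} (_ , inj₂ refl , zero , _ , refl) =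
    inj₂ (refl , d , inj₁ refl , 0 , alive-0 , cong (v ,_) (sym (neg-involutive d)))

  colour-visits : ∀ {t p f} → Visits t (p , f) → colour p ≡ colour v
  colour-visits (r , _ , k , _ , refl) = colour-ray r k

  initial : Trail180 m n v → Dir
  initial (oneRay d _)    = d
  initial (twoRays d _ _) = d

  initial-isRay : ∀ t → IsRay t (initial t)
  initial-isRay (oneRay _ _)    = refl
  initial-isRay (twoRays _ _ _) = inj₁ refl

  ray-slope : ∀ t {r} → IsRay t r → slope r ≡ slope (initial t)
  ray-slope (oneRay _ _)    refl        = refl
  ray-slope (twoRays _ _ _) (inj₁ refl) = refl
  ray-slope (twoRays d _ _) (inj₂ refl) = slope-neg d

  visits-v-slope : ∀ t {f} → Visits t (v , f) → slope f ≡ slope (initial t)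
  visits-v-slope t (r , ray , zero , _ , at-0) = trans (cong (slope ∘ proj₂) (sym at-0)) (ray-slope t ray)
  visits-v-slope t (r , ray , suc k , alive , at-k) =
    trans (cong slope (return-direction t ray (s≤s z≤n) alive at-k)) (ray-slope t ray)

module Crossings {m n : ℕ} {v : Pt} (v∈G : InGrid m n v) where
  open Billiard m n
  open Rays v∈G
  open Trails v∈G

  -- The direction stored at a point of the boundary of R is the outgoing one,
  -- so there a visit counts for both slopes.
  Crosses : Trail180 m n v → Pt → Bool → Set
  Crosses t p s = ∃[ f ] (Visits t (p , f) × (InGrid m n p → slope f ≡ s))

  Crosses? : ∀ t p s → Dec (Crosses t p s)
  Crosses? t p s = ∃-Dir? λ f → Visits? t (p , f) ×-dec (InGrid? p →-dec (slope f Bool.≟ s))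

  crosses : Trail180 m n v → Pt → Bool → Bool
  crosses t p s = does (Crosses? t p s)

  crosses-forward : ∀ {t q e} → Visits t (q , e) → ¬ IsCorner m n q → Crosses t (move e q) (slope e)
  crosses-forward {q = q} {e} vis q∉corner =
    _ , visits-step vis q∉corner , cong slope ∘ step-direction-in-grid q e

  crosses-move : ∀ {t q e} → ¬ IsCorner m n q → Admissible₂ (q , e)
               → Crosses t q (slope e) → Crosses t (move e q) (slope e)
  crosses-move {t} {q} {e} q∉corner adm (f , vis , slope-f) with f ≟ᵈ e
  ... | yes refl = crosses-forward vis q∉corner
  ... | no f≢e with visits-predecessor vis
  ...   | inj₁ (s , vis-s , step-s) =
    neg e , subst (Visits t) (step-predecessor (visits-admissible vis-s) step-s q∉corner adm f≢e slope-f) vis-s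
          , λ _ → slope-neg e
  ...   | inj₂ (refl , vis-neg) = crosses-forward (subst (λ d → Visits t (v , d)) neg-f≡e vis-neg) q∉corner
    where
    neg-f≡e : neg f ≡ e
    neg-f≡e = trans (cong neg (same-slope (slope-f v∈G) f≢e)) (neg-involutive e)

  crosses-edge : ∀ {t p e} → ¬ IsCorner m n p → ¬ IsCorner m n (move e p)
               → Admissible₂ (p , e) → Admissible₂ (move e p , neg e)
               → crosses t p (slope e) ≡ crosses t (move e p) (slope e)
  crosses-edge {t} {p} {e} p∉corner q∉corner adm adm′ =
    does-⇔ (mk⇔ (crosses-move p∉corner adm) back) (Crosses? t p (slope e)) (Crosses? t (move e p) (slope e))
    where
    back : Crosses t (move e p) (slope e) → Crosses t p (slope e)
    back = subst₂ (Crosses t) (move-inverse p e adm) (slope-neg e)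
         ∘ crosses-move q∉corner adm′
         ∘ subst (Crosses t (move e p)) (sym (slope-neg e))

  onTrail⇔crosses : ∀ t {w s} → InGrid m n w → OnTrail t w s ⇔ Crosses t w s
  onTrail⇔crosses t {w} {s} w∈G = mk⇔ (to t) (from t)
    where
    onRay⇒crosses : ∀ t {r} → IsRay t r → OnRay m n v r w s → Crosses t w s
    onRay⇒crosses t ray (k , alive , refl , refl) = _ , (_ , ray , k , alive , refl) , λ _ → refl
    crosses⇒onRay : ∀ {r k f} → Alive m n v r k → iter m n k (v , r) ≡ (w , f)
                  → (InGrid m n w → slope f ≡ s) → OnRay m n v r w s
    crosses⇒onRay alive at slope-f = _ , alive , cong proj₁ at , trans (cong (slope ∘ proj₂) at) (slope-f w∈G)
    to : ∀ t → OnTrail t w s → Crosses t w s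
    to t@(oneRay _ _)    = onRay⇒crosses t refl
    to t@(twoRays _ _ _) = [ onRay⇒crosses t (inj₁ refl) , onRay⇒crosses t (inj₂ refl) ]
    from : ∀ t → Crosses t w s → OnTrail t w s
    from (oneRay _ _)    (_ , (_ , refl , _ , alive , at) , slope-f)      = crosses⇒onRay alive at slope-f
    from (twoRays _ _ _) (_ , (_ , inj₁ refl , _ , alive , at) , slope-f) = inj₁ (crosses⇒onRay alive at slope-f)
    from (twoRays _ _ _) (_ , (_ , inj₂ refl , _ , alive , at) , slope-f) = inj₂ (crosses⇒onRay alive at slope-f)

  crosses-off-grid : ∀ {t p s s′} → ¬ InGrid m n p → Crosses t p s → Crosses t p s′
  crosses-off-grid p∉G (f , vis , _) = f , vis , ⊥-elim ∘ p∉G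

  member⇔crosses-xor : ∀ t p → crosses t p false xor crosses t p true ≡ true ⇔ ExactlyOneSeg t p
  member⇔crosses-xor t p = mk⇔ to from
    where
    one⇔ = xor-does (Crosses? t p false) (Crosses? t p true)
    to : crosses t p false xor crosses t p true ≡ true → ExactlyOneSeg t p
    to h with InGrid? p | Equivalence.to one⇔ h
    ... | yes p∈G | one = p∈G , exactlyOne-map (⇔-sym (onTrail⇔crosses t p∈G)) (⇔-sym (onTrail⇔crosses t p∈G)) one
    ... | no p∉G | inj₁ (cf , ¬ct) = ⊥-elim (¬ct (crosses-off-grid p∉G cf))
    ... | no p∉G | inj₂ (ct , ¬cf) = ⊥-elim (¬cf (crosses-off-grid p∉G ct))
    from : ExactlyOneSeg t p → crosses t p false xor crosses t p true ≡ true
    from (p∈G , one) = Equivalence.from one⇔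
      (exactlyOne-map (onTrail⇔crosses t p∈G) (onTrail⇔crosses t p∈G) one)

  -- east, north, west and south span a diamond of unit diagonal segments; the
  -- four arguments of xor-cycle-even are the values of crosses on its sides.
  even-neighbours : ∀ t x → InGrid m n x → EvenNbrs m n (ExactlyOneSeg t) x
  even-neighbours t (suc i , suc j) ((s≤s z≤n , i<m) , (s≤s z≤n , j<n)) =
    c , reflects , subst (2 ∣_) (sym count)
      (xor-cycle-even (crosses t east true) (crosses t west false) (crosses t west true) (crosses t east false))
    where
    x east west north south : Pt
    x     = suc i , suc j
    east  = suc (suc i) , suc j
    west  = i , suc j
    north = suc i , suc (suc j)
    south = suc i , j
    c : Fin 4 → Bool
    c k = crosses t (nb k x) false xor crosses t (nb k x) true
    reflects : ∀ k → (c k ≡ true → InGrid m n (nb k x) × ExactlyOneSeg t (nb k x))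
                   × (InGrid m n (nb k x) × ExactlyOneSeg t (nb k x) → c k ≡ true)
    reflects k = (λ h → let e = Equivalence.to (member⇔crosses-xor t _) h in proj₁ e , e)
               , Equivalence.from (member⇔crosses-xor t _) ∘ proj₂
    1≤ : ∀ {k} → 1 ≤ suc k
    1≤ = s≤s z≤n
    ∉corner-x : ∀ {y} → ¬ IsCorner m n (suc i , y)
    ∉corner-x = interior-x⇒¬IsCorner 1≤ i<m
    ∉corner-y : ∀ {x} → ¬ IsCorner m n (x , suc j)
    ∉corner-y = interior-y⇒¬IsCorner 1≤ j<n
    north-west : crosses t north false ≡ crosses t west false
    north-west = crosses-edge {t} {e = false , false} ∉corner-x ∉corner-y
      (interior-admissible false 1≤ i<m , (1≤ , s≤s j<n)) (s≤s (<⇒≤ i<m) , interior-admissible true 1≤ j<n)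
    north-east : crosses t north true ≡ crosses t east true
    north-east = crosses-edge {t} {e = true , false} ∉corner-x ∉corner-y
      (interior-admissible true 1≤ i<m , (1≤ , s≤s j<n)) ((1≤ , s≤s i<m) , interior-admissible true 1≤ j<n)
    south-east : crosses t south false ≡ crosses t east false
    south-east = crosses-edge {t} {e = true , true} ∉corner-x ∉corner-y
      (interior-admissible true 1≤ i<m , s≤s (<⇒≤ j<n)) ((1≤ , s≤s i<m) , interior-admissible false 1≤ j<n)
    south-west : crosses t south true ≡ crosses t west true
    south-west = crosses-edge {t} {e = false , true} ∉corner-x ∉corner-y
      (interior-admissible false 1≤ i<m , s≤s (<⇒≤ j<n)) (s≤s (<⇒≤ i<m) , interior-admissible false 1≤ j<n)
    count : count4 c ≡ b2n (crosses t east false xor crosses t east true)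
                     + (b2n (crosses t west false xor crosses t west true)
                     + (b2n (crosses t west false xor crosses t east true)
                     + b2n (crosses t east false xor crosses t west true)))
    count = cong₂ (λ c₂ c₃ → b2n (c Fin.zero) + (b2n (c (Fin.suc Fin.zero)) + (b2n c₂ + b2n c₃)))
                  (cong₂ _xor_ north-west north-east) (cong₂ _xor_ south-east south-west)

  v-member : ∀ t → ExactlyOneSeg t v
  v-member t = v∈G , exactlyOne-at {OnTrail t v} (slope (initial t))
    (Equivalence.from (onTrail⇔crosses t v∈G) (initial t , start , λ _ → refl))
    λ on → let (f , vis , slope-f) = Equivalence.to (onTrail⇔crosses t v∈G) on in
           not-¬ (visits-v-slope t vis) (slope-f v∈G)
    where
    start : Visits t (v , initial t)
    start = initial t , initial-isRay t , 0 , alive-0 , refl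

  colour-onTrail : ∀ t {p s} → InGrid m n p → OnTrail t p s → colour p ≡ colour v
  colour-onTrail t p∈G on = colour-visits (proj₁ (proj₂ (Equivalence.to (onTrail⇔crosses t p∈G) on)))

  colour-member : ∀ t {p} → ExactlyOneSeg t p → colour p ≡ colour v
  colour-member t (p∈G , inj₁ (on , _)) = colour-onTrail t p∈G on
  colour-member t (p∈G , inj₂ (on , _)) = colour-onTrail t p∈G on

  members-independent : ∀ t x y → Adj x y → ExactlyOneSeg t x → ExactlyOneSeg t y → ⊥
  members-independent t (zero , _)        _ _ (((() , _) , _) , _) _
  members-independent t (suc _ , zero)    _ _ ((_ , (() , _)) , _) _
  members-independent t (suc _ , suc _) _ x~y x∈S y∈S =
    not-¬ (trans (colour-member t y∈S) (sym (colour-member t x∈S))) (colour-adjacent x~y)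

lemma2p6 : (m n : ℕ) → 1 ≤ m → 1 ≤ n → (v : Pt) → InGrid m n v
         → (t : Trail180 m n v)
         → EvenKernel m n (ExactlyOneSeg t) × ExactlyOneSeg t v
-- 1 ≤ m and 1 ≤ n already follow from InGrid m n v.
lemma2p6 m n _ _ v v∈G t =
  record { subset      = λ _ → proj₁
         ; nonempty    = v , v-member t
         ; independent = members-independent t
         ; even        = λ x x∈G _ → even-neighbours t x x∈G
         } , v-member t
  where open Crossings v∈G
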